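{- Let $G$ be a connected cubic graph with a $1$-factor $F$ and let $X=G/F$. There is a one-to-one correspondence between the $2$-factors $T$ of $G$ and the admissible spanning subgraphs $W$ of $X$ in which every vertex has degree $2$ or $4$, such that the number of cycles of $T$ equals the number of closed trails in the decomposition of $W$ into closed trails with allowed transitions.
   Context: Let $Y=G-F$. $X=G/F$ is the quartic multigraph obtained by contracting each edge $e=uv\in F$ to a vertex $x_e$; the edges of $X$ are the edges of $Y$, and the four edge-ends at $x_e$ correspond to the four edge-ends of $Y$ at $u$ and $v$. A transition at $x_e$ is an unordered pair of distinct edge-ends at $x_e$; it is non-traversing if both edge-ends come from the same end of $e$, traversing otherwise. A spanning subgraph $W$ of $X$ with all degrees in $\{2,4\}$ is admissible if at each vertex of degree $2$ in $W$ the transition formed by its two edge-ends is traversing. The decomposition of $W$ into closed trails with allowed transitions is obtained by pairing, at each degree-$4$ vertex of $W$, the edge-ends according to the two non-traversing transitions, and at each degree-$2$ vertex, the two edge-ends with each other; this pairing splits the edge set of $W$ uniquely into closed trails (the components of a tour with allowed transitions). -}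

module Defs where

open import Data.Nat using (ℕ; _+_)
open import Data.Fin using (Fin)
open import Data.Bool using (Bool; true; false; _∧_; not; if_then_else_)
open import Data.List using (map; allFin)
open import Data.Nat.ListAction using (sum)
open import Data.Product using (Σ; _×_; ∃; _,_)
open import Data.Sum using (_⊎_)
open import Relation.Binary.PropositionalEquality using (_≡_; _≢_)
open import Relation.Binary.Construct.Closure.ReflexiveTransitive using (Star)
open import Relation.Binary.Construct.Closure.Symmetric using (SymClosure)
open import Function.Bundles using (_⇔_)

-- A (multi-edge-free) graph / edge set on vertex set Fin n, as a Boolean
-- adjacency matrix; M i j ≡ true means the edge {i,j} is present.
Mat : ℕ → Set
Mat n = Fin n → Fin n → Bool

_≐_ : ∀ {n} → Mat n → Mat n → Set
M ≐ N = ∀ i j → M i j ≡ N i j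

Symmetric : ∀ {n} → Mat n → Set
Symmetric M = ∀ i j → M i j ≡ M j i

Loopless : ∀ {n} → Mat n → Set
Loopless M = ∀ i → M i i ≡ false

IsGraph : ∀ {n} → Mat n → Set
IsGraph M = Symmetric M × Loopless M

_⊆ₘ_ : ∀ {n} → Mat n → Mat n → Set
M ⊆ₘ N = ∀ i j → M i j ≡ true → N i j ≡ true

deg : ∀ {n} → Mat n → Fin n → ℕ
deg {n} M i = sum (map (λ j → if M i j then 1 else 0) (allFin n))

Edge : ∀ {n} → Mat n → Fin n → Fin n → Set
Edge M i j = M i j ≡ true

Connected : ∀ {n} → Mat n → Set
Connected M = ∀ i j → Star (Edge M) i j

Cubic : ∀ {n} → Mat n → Set
Cubic G = ∀ i → deg G i ≡ 3

OneFactor : ∀ {n} → Mat n → Mat n → Set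
OneFactor G F = Symmetric F × F ⊆ₘ G × (∀ i → deg F i ≡ 1)

TwoFactor : ∀ {n} → Mat n → Mat n → Set
TwoFactor G T = Symmetric T × T ⊆ₘ G × (∀ i → deg T i ≡ 2)

NumComponents : (A : Set) → (A → A → Set) → ℕ → Set
NumComponents A R k =
  Σ (A → Fin k) λ c →
    (∀ l → ∃ λ x → c x ≡ l) ×
    (∀ x y → (c x ≡ c y) ⇔ Star (SymClosure R) x y)

NumCycles : ∀ {n} → Mat n → ℕ → Set
NumCycles {n} T k = NumComponents (Fin n) (Edge T) k

Y : ∀ {n} → Mat n → Mat n → Mat n
Y G F i j = G i j ∧ not (F i j)

-- X = G/F: the vertex x_e for e = aa' ∈ F is represented by its two
-- ends a, a'.  A spanning subgraph W of X is a set of edges of Y.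
-- The degree of x_e in W is deg W a + deg W a' (edge-ends at x_e are the
-- W-edge-ends at a and at a').  The transition at a degree-2 vertex x_e
-- is traversing iff one edge-end comes from a and one from a'.
AdmissibleW : ∀ {n} → Mat n → Mat n → Mat n → Set
AdmissibleW G F W =
  Symmetric W × W ⊆ₘ Y G F ×
  (∀ a a' → F a a' ≡ true →
     ((deg W a + deg W a' ≡ 2) ⊎ (deg W a + deg W a' ≡ 4)) ×
     (deg W a + deg W a' ≡ 2 → (deg W a ≡ 1 × deg W a' ≡ 1)))

-- edge-ends of W: (a , b , _) is the end at a of the W-edge {a,b}
Dart : ∀ {n} → Mat n → Set
Dart {n} W = Σ (Fin n) λ a → Σ (Fin n) λ b → W a b ≡ true

data SameEdge {n} (W : Mat n) : Dart W → Dart W → Set where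
  rev : ∀ {a b} (p : W a b ≡ true) (q : W b a ≡ true) →
        SameEdge W (a , b , p) (b , a , q)

-- the pairing of edge-ends at the vertices of X:
-- at a degree-4 vertex x_e (e = aa') the two ends at a are paired
-- (and the two ends at a'), i.e. the non-traversing transitions;
-- at a degree-2 vertex the two edge-ends are paired with each other.
data Paired {n} (F W : Mat n) : Dart W → Dart W → Set where
  deg4 : ∀ {a a' b d} (p : W a b ≡ true) (q : W a d ≡ true) →
         F a a' ≡ true → deg W a + deg W a' ≡ 4 → b ≢ d →
         Paired F W (a , b , p) (a , d , q)
  deg2-same : ∀ {a a' b d} (p : W a b ≡ true) (q : W a d ≡ true) →
         F a a' ≡ true → deg W a + deg W a' ≡ 2 → b ≢ d →
         Paired F W (a , b , p) (a , d , q)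
  deg2-other : ∀ {a a' b d} (p : W a b ≡ true) (q : W a' d ≡ true) →
         F a a' ≡ true → deg W a + deg W a' ≡ 2 →
         Paired F W (a , b , p) (a' , d , q)

Link : ∀ {n} → Mat n → (W : Mat n) → Dart W → Dart W → Set
Link F W x y = SameEdge W x y ⊎ Paired F W x y

-- number of closed trails in the decomposition of W into closed trails
-- with allowed transitions = number of components of the linking of edge-ends
NumTrails : ∀ {n} → Mat n → Mat n → ℕ → Set
NumTrails F W k = NumComponents (Dart W) (Link F W) k

module Submission where

-- For a cubic G with perfect matching F, the bijection sends a 2-factor T to
-- φ T = T - F, a set of edges of Y = G - F.  Everything rests on one local
-- fact: at an F-edge aa' a 2-factor either uses aa' (then x_aa' has degree 2
-- in φ T, one edge-end from a and one from a') or avoids it (then x_aa' has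
-- degree 4); so both ends of aa' have the same φ T-degree, 1 or 2.  Hence
-- T = restore (φ T), where restore W adds the F-edges whose ends have
-- W-degree 1; this gives injectivity, and restore turns every admissible W
-- into a 2-factor, giving surjectivity.  For the counts, "vertex ↦ some
-- edge-end of φ T there" and "edge-end ↦ its vertex" map T-edges to chains of
-- linked edge-ends and links to T-paths, so a general transfer principle
-- shows that T and φ T have equally many components.

open import Defs
open import Data.Nat using (ℕ; zero; suc; _+_; _≤_; z≤n; s≤s; _≡ᵇ_)
open import Data.Nat.Properties
  using (+-identityʳ; +-cancelʳ-≡; +-cancelˡ-≡; +-cancelʳ-≤; +-mono-≤; +-monoʳ-≤;
         m≤n+m; ≤-trans; ≤-antisym; ≤-refl; +-0-commutativeMonoid; module ≤-Reasoning)
open import Data.Nat.ListAction using () renaming (sum to listSum)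
open import Algebra.Properties.CommutativeMonoid.Sum +-0-commutativeMonoid
  using (sum; ∑-distrib-+; sum-cong-≗)
open import Data.Fin using (Fin; zero; suc)
open import Data.Fin.Properties using (any?; 0≢1+n) renaming (_≟_ to _≟ᶠ_; suc-injective to fsuc-injective)
open import Data.Bool using (Bool; true; false; _∧_; _∨_; not; if_then_else_)
open import Data.Bool.Properties
  using (∧-identityʳ; ∧-zeroʳ; ∨-identityʳ; ∧-conicalˡ; ∧-conicalʳ) renaming (_≟_ to _≟ᵇ_)
open import Data.List using (tabulate)
open import Data.List.Properties using (map-tabulate)
open import Data.Product using (Σ; _×_; ∃; _,_; proj₁; proj₂)
open import Data.Sum using (_⊎_; inj₁; inj₂)
open import Data.Empty using (⊥-elim)
open import Relation.Nullary using (¬_; yes; no)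
open import Relation.Binary.PropositionalEquality
  using (_≡_; _≢_; refl; sym; trans; cong; cong₂; subst; module ≡-Reasoning)
open import Relation.Binary.Construct.Closure.ReflexiveTransitive using (ε; _◅_; _◅◅_)
open import Relation.Binary.Construct.Closure.Symmetric using (fwd)
open import Relation.Binary.Construct.Closure.Equivalence
  using (EqClosure; gfold; isEquivalence) renaming (symmetric to eq-sym)
open import Function.Bundles using (_⇔_; mk⇔; Equivalence)
open import Function using (_∘_)
open import Axiom.UniquenessOfIdentityProofs using (module Decidable⇒UIP)

ind : Bool → ℕ
ind b = if b then 1 else 0

count : ∀ {n} → (Fin n → Bool) → ℕ
count p = sum (λ j → ind (p j))

listSum-tabulate : ∀ {n} (h : Fin n → ℕ) → listSum (tabulate h) ≡ sum h
listSum-tabulate {zero} h = refl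
listSum-tabulate {suc n} h = cong (h zero +_) (listSum-tabulate (h ∘ suc))

deg≡count : ∀ {n} (M : Mat n) i → deg M i ≡ count (M i)
deg≡count M i =
  trans (cong listSum (map-tabulate (λ j → j) (λ j → ind (M i j))))
        (listSum-tabulate (λ j → ind (M i j)))

count-cong : ∀ {n} {p q : Fin n → Bool} → (∀ j → p j ≡ q j) → count p ≡ count q
count-cong eq = sum-cong-≗ (cong ind ∘ eq)

deg-cong : ∀ {n} (M N : Mat n) i → (∀ j → M i j ≡ N i j) → deg M i ≡ deg N i
deg-cong M N i eq = trans (deg≡count M i) (trans (count-cong eq) (sym (deg≡count N i)))

ind-split : ∀ x y → ind x ≡ ind (x ∧ not y) + ind (x ∧ y)
ind-split true true = refl
ind-split true false = refl
ind-split false y = refl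

count-split : ∀ {n} (p q : Fin n → Bool) →
  count p ≡ count (λ j → p j ∧ not (q j)) + count (λ j → p j ∧ q j)
count-split p q =
  trans (sum-cong-≗ (λ j → ind-split (p j) (q j)))
        (∑-distrib-+ (λ j → ind (p j ∧ not (q j))) (λ j → ind (p j ∧ q j)))

ind-mono : ∀ {x y} → (x ≡ true → y ≡ true) → ind x ≤ ind y
ind-mono {false} _ = z≤n
ind-mono {true} x⇒y rewrite x⇒y refl = ≤-refl

count-mono : ∀ {n} {p q : Fin n → Bool} → (∀ j → p j ≡ true → q j ≡ true) → count p ≤ count q
count-mono {zero} _ = z≤n
count-mono {suc n} p⊆q = +-mono-≤ (ind-mono (p⊆q zero)) (count-mono (p⊆q ∘ suc))

ind-false : ∀ {x} → x ≢ true → ind x ≡ 0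
ind-false {true} x≢true = ⊥-elim (x≢true refl)
ind-false {false} _ = refl

count-zero : ∀ {n} {p : Fin n → Bool} → (∀ j → p j ≢ true) → count p ≡ 0
count-zero {zero} _ = refl
count-zero {suc n} none = cong₂ _+_ (ind-false (none zero)) (count-zero (none ∘ suc))

count-point : ∀ {n} {p : Fin n → Bool} j → (∀ k → p k ≡ true → k ≡ j) → count p ≡ ind (p j)
count-point {suc n} {p} zero only-j =
  trans (cong (ind (p zero) +_) (count-zero (λ k pk → 0≢1+n (sym (only-j (suc k) pk)))))
        (+-identityʳ (ind (p zero)))
count-point {suc n} {p} (suc j) only-j =
  cong₂ _+_ (ind-false (λ p0 → 0≢1+n (only-j zero p0)))
            (count-point j (λ k pk → fsuc-injective (only-j (suc k) pk)))

count-pos : ∀ {n} {p : Fin n → Bool} j → p j ≡ true → 1 ≤ count p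
count-pos {suc n} {p} zero p0 rewrite p0 = s≤s z≤n
count-pos {suc n} {p} (suc j) pj = ≤-trans (count-pos j pj) (m≤n+m _ (ind (p zero)))

count-two : ∀ {n} {p : Fin n → Bool} j k → j ≢ k → p j ≡ true → p k ≡ true → 2 ≤ count p
count-two zero zero j≢k _ _ = ⊥-elim (j≢k refl)
count-two zero (suc k) _ pj pk rewrite pj = s≤s (count-pos k pk)
count-two (suc j) zero _ pj pk rewrite pk = s≤s (count-pos j pj)
count-two {p = p} (suc j) (suc k) j≢k pj pk =
  ≤-trans (count-two j k (j≢k ∘ cong suc) pj pk) (m≤n+m _ (ind (p zero)))

count-witness : ∀ {n} (p : Fin n → Bool) → count p ≢ 0 → ∃ λ j → p j ≡ true
count-witness p count≢0 with any? (λ j → p j ≟ᵇ true)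
... | yes found = found
... | no none = ⊥-elim (count≢0 (count-zero (λ j pj → none (j , pj))))

module _ {A B : Set} {R : A → A → Set} {Q : B → B → Set} (f : A → B) (g : B → A)
  (f-resp : ∀ {x y} → R x y → EqClosure Q (f x) (f y))
  (g-resp : ∀ {u v} → Q u v → EqClosure R (g u) (g v))
  (fg : ∀ u → EqClosure Q (f (g u)) u)
  (gf : ∀ x → EqClosure R (g (f x)) x) where

  components-transfer : ∀ k → NumComponents A R k → NumComponents B Q k
  components-transfer k (c , c-onto , c-classes) = c ∘ g , onto , classes
    where
    lift-f : ∀ {x y} → EqClosure R x y → EqClosure Q (f x) (f y)
    lift-f = gfold (isEquivalence Q) f f-resp
    lift-g : ∀ {u v} → EqClosure Q u v → EqClosure R (g u) (g v)
    lift-g = gfold (isEquivalence R) g g-resp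
    onto : ∀ l → ∃ λ u → c (g u) ≡ l
    onto l with c-onto l
    ... | x , cx≡l = f x , trans (Equivalence.from (c-classes (g (f x)) x) (gf x)) cx≡l
    classes : ∀ u v → (c (g u) ≡ c (g v)) ⇔ EqClosure Q u v
    classes u v = mk⇔
      (λ same → eq-sym Q (fg u) ◅◅ lift-f (Equivalence.to (c-classes (g u) (g v)) same) ◅◅ fg v)
      (λ u~v → Equivalence.from (c-classes (g u) (g v)) (lift-g u~v))

∨-true : ∀ {x y} → x ∨ y ≡ true → x ≡ true ⊎ y ≡ true
∨-true {true} _ = inj₁ refl
∨-true {false} y = inj₂ y

true≢false : ∀ {A : Set} → true ≡ false → A
true≢false ()

not-true : ∀ {x} → not x ≡ true → x ≡ false
not-true {false} _ = refl

∧-cong-guarded : ∀ {a a' b c : Bool} → a ≡ a' → (a ≡ true → b ≡ c) → a ∧ b ≡ a' ∧ c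
∧-cong-guarded {false} refl _ = refl
∧-cong-guarded {true} refl b≡c = b≡c refl

both-two : ∀ {x y} → x ≤ 2 → y ≤ 2 → x + y ≡ 4 → x ≡ 2 × y ≡ 2
both-two {x} {y} x≤2 y≤2 x+y≡4 = x≡2 , +-cancelˡ-≡ 2 y 2 (subst (λ z → z + y ≡ 4) x≡2 x+y≡4)
  where
  x≡2 : x ≡ 2
  x≡2 = ≤-antisym x≤2 (+-cancelʳ-≤ y 2 x (subst (2 + y ≤_) (sym x+y≡4) (+-monoʳ-≤ 2 y≤2)))

module CubicWithMatching {n : ℕ} (G F : Mat n) (cubic : Cubic G) (matching : OneFactor G F) where

  F-sym : Symmetric F
  F-sym = proj₁ matching

  F⊆G : F ⊆ₘ G
  F⊆G = proj₁ (proj₂ matching)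

  deg-F : ∀ a → deg F a ≡ 1
  deg-F = proj₂ (proj₂ matching)

  F-unique : ∀ {a b c} → F a b ≡ true → F a c ≡ true → b ≡ c
  F-unique {a} {b} {c} ab ac with b ≟ᶠ c
  ... | yes b≡c = b≡c
  ... | no b≢c = ⊥-elim (two≰one (subst (2 ≤_) (trans (sym (deg≡count F a)) (deg-F a))
                                          (count-two b c b≢c ab ac)))
    where
    two≰one : ¬ (2 ≤ 1)
    two≰one (s≤s ())

  partner-exists : ∀ a → ∃ λ a' → F a a' ≡ true
  partner-exists a = count-witness (F a) (λ count≡0 → one≢zero (trans (sym (deg-F a))
                                                            (trans (deg≡count F a) count≡0)))
    where
    one≢zero : 1 ≢ 0
    one≢zero ()

  partner : Fin n → Fin n
  partner a = proj₁ (partner-exists a)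

  partner-F : ∀ a → F a (partner a) ≡ true
  partner-F a = proj₂ (partner-exists a)

  deg-split : ∀ (M : Mat n) {a a'} → F a a' ≡ true → deg M a ≡ deg (Y M F) a + ind (M a a')
  deg-split M {a} {a'} aa' = begin
    deg M a                                                   ≡⟨ deg≡count M a ⟩
    count (M a)                                               ≡⟨ count-split (M a) (F a) ⟩
    count (Y M F a) + count (λ j → M a j ∧ F a j)             ≡⟨ cong₂ _+_ (sym (deg≡count (Y M F) a))
                                                                          (count-point a' only-a') ⟩
    deg (Y M F) a + ind (M a a' ∧ F a a')                     ≡⟨ cong (λ b → deg (Y M F) a + ind (M a a' ∧ b)) aa' ⟩
    deg (Y M F) a + ind (M a a' ∧ true)                       ≡⟨ cong (λ b → deg (Y M F) a + ind b) (∧-identityʳ _) ⟩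
    deg (Y M F) a + ind (M a a')                              ∎
    where
    open ≡-Reasoning
    only-a' : ∀ k → M a k ∧ F a k ≡ true → k ≡ a'
    only-a' k ak = F-unique (∧-conicalʳ (M a k) (F a k) ak) aa'

  deg-Y : ∀ a → deg (Y G F) a ≡ 2
  deg-Y a = +-cancelʳ-≡ 1 (deg (Y G F) a) 2 (begin
    deg (Y G F) a + 1                    ≡⟨ cong (λ b → deg (Y G F) a + ind b) (sym (F⊆G a _ (partner-F a))) ⟩
    deg (Y G F) a + ind (G a (partner a)) ≡⟨ sym (deg-split G (partner-F a)) ⟩
    deg G a                              ≡⟨ cubic a ⟩
    3                                    ∎)
    where open ≡-Reasoning

  Y-sym : ∀ {M} → Symmetric M → Symmetric (Y M F)
  Y-sym M-sym i j = cong₂ _∧_ (M-sym i j) (cong not (F-sym i j))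

  Y-mono : ∀ {M N} → M ⊆ₘ N → Y M F ⊆ₘ Y N F
  Y-mono M⊆N i j ij =
    subst (λ b → b ∧ not (F i j) ≡ true) (sym (M⊆N i j (∧-conicalˡ _ _ ij))) (∧-conicalʳ _ _ ij)

  deg-≤2 : ∀ {W} → W ⊆ₘ Y G F → ∀ a → deg W a ≤ 2
  deg-≤2 {W} W⊆Y a = begin
    deg W a          ≡⟨ deg≡count W a ⟩
    count (W a)      ≤⟨ count-mono (W⊆Y a) ⟩
    count (Y G F a)  ≡⟨ sym (deg≡count (Y G F) a) ⟩
    deg (Y G F) a    ≡⟨ deg-Y a ⟩
    2                ∎
    where open ≤-Reasoning

  off-F : ∀ {W} → W ⊆ₘ Y G F → ∀ {i j} → F i j ≡ true → W i j ≡ false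
  off-F {W} W⊆Y {i} {j} ij with W i j in eW
  ... | false = refl
  ... | true with trans (sym (not-true (∧-conicalʳ _ _ (W⊆Y i j eW)))) ij
  ...   | ()

  Balanced : Mat n → Fin n → Fin n → Set
  Balanced W a a' = deg W a ≡ deg W a' × (deg W a ≡ 1 ⊎ deg W a ≡ 2)

  balanced⇒admissible : ∀ {W} → Symmetric W → W ⊆ₘ Y G F →
    (∀ a a' → F a a' ≡ true → Balanced W a a') → AdmissibleW G F W
  balanced⇒admissible {W} W-sym W⊆Y balanced = W-sym , W⊆Y , local
    where
    local : ∀ a a' → F a a' ≡ true →
      ((deg W a + deg W a' ≡ 2) ⊎ (deg W a + deg W a' ≡ 4)) ×
      (deg W a + deg W a' ≡ 2 → (deg W a ≡ 1 × deg W a' ≡ 1))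
    local a a' aa' with balanced a a' aa'
    ... | same , inj₁ one rewrite sym same | one = inj₁ refl , λ _ → refl , refl
    ... | same , inj₂ two rewrite sym same | two = inj₂ refl , λ ()

  admissible⇒balanced : ∀ {W} → AdmissibleW G F W → ∀ {a a'} → F a a' ≡ true → Balanced W a a'
  admissible⇒balanced {W} (_ , W⊆Y , local) {a} {a'} aa' with local a a' aa'
  ... | inj₁ sum≡2 , traversing = let (one , one') = traversing sum≡2 in trans one (sym one') , inj₁ one
  ... | inj₂ sum≡4 , _ =
    let (two , two') = both-two (deg-≤2 W⊆Y a) (deg-≤2 W⊆Y a') sum≡4 in trans two (sym two') , inj₂ two

  used-or-avoided : ∀ {T} → TwoFactor G T → ∀ {a a'} → F a a' ≡ true →
    (T a a' ≡ true × deg (Y T F) a ≡ 1) ⊎ (T a a' ≡ false × deg (Y T F) a ≡ 2)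
  used-or-avoided {T} (_ , _ , deg-T) {a} {a'} aa' =
    by-usage refl (trans (sym (deg-split T aa')) (deg-T a))
    where
    by-usage : ∀ {b} → T a a' ≡ b → deg (Y T F) a + ind b ≡ 2 →
      (T a a' ≡ true × deg (Y T F) a ≡ 1) ⊎ (T a a' ≡ false × deg (Y T F) a ≡ 2)
    by-usage {true} used d+1≡2 = inj₁ (used , +-cancelʳ-≡ 1 _ 1 d+1≡2)
    by-usage {false} avoided d+0≡2 = inj₂ (avoided , trans (sym (+-identityʳ _)) d+0≡2)

  twoFactor-balanced : ∀ {T} → TwoFactor G T → ∀ {a a'} → F a a' ≡ true → Balanced (Y T F) a a'
  twoFactor-balanced {T} tf@(T-sym , _ , _) {a} {a'} aa'
    with used-or-avoided tf aa' | used-or-avoided tf (trans (F-sym a' a) aa')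
  ... | inj₁ (_ , one) | inj₁ (_ , one') = trans one (sym one') , inj₁ one
  ... | inj₂ (_ , two) | inj₂ (_ , two') = trans two (sym two') , inj₂ two
  ... | inj₁ (used , _) | inj₂ (avoided , _) = true≢false (trans (sym used) (trans (T-sym a a') avoided))
  ... | inj₂ (avoided , _) | inj₁ (used , _) = true≢false (trans (sym used) (trans (T-sym a' a) avoided))

  φ-admissible : ∀ {T} → TwoFactor G T → AdmissibleW G F (Y T F)
  φ-admissible tf@(T-sym , T⊆G , _) =
    balanced⇒admissible (Y-sym T-sym) (Y-mono T⊆G) (λ _ _ → twoFactor-balanced tf)

  uses-F-edge : ∀ {T} → TwoFactor G T → ∀ {a a'} → F a a' ≡ true → T a a' ≡ (deg (Y T F) a ≡ᵇ 1)
  uses-F-edge tf aa' with used-or-avoided tf aa'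
  ... | inj₁ (used , one) rewrite one = used
  ... | inj₂ (avoided , two) rewrite two = avoided

  restore : Mat n → Mat n
  restore W i j = W i j ∨ (F i j ∧ (deg W i ≡ᵇ 1))

  restore-cong : ∀ {W W'} → W ≐ W' → restore W ≐ restore W'
  restore-cong {W} {W'} eq i j =
    cong₂ _∨_ (eq i j) (cong (λ d → F i j ∧ (d ≡ᵇ 1)) (deg-cong W W' i (eq i)))

  restore-φ : ∀ {T} → TwoFactor G T → restore (Y T F) ≐ T
  restore-φ {T} tf i j with F i j in eF
  ... | true = trans (cong (_∨ (deg (Y T F) i ≡ᵇ 1)) (∧-zeroʳ (T i j))) (sym (uses-F-edge tf eF))
  ... | false = trans (∨-identityʳ _) (∧-identityʳ (T i j))

  φ-restore : ∀ {W} → W ⊆ₘ Y G F → Y (restore W) F ≐ W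
  φ-restore {W} W⊆Y i j with F i j in eF
  ... | true = trans (∧-zeroʳ _) (sym (off-F W⊆Y eF))
  ... | false = trans (∧-identityʳ _) (∨-identityʳ (W i j))

  restore-on-F : ∀ {W} → W ⊆ₘ Y G F → ∀ {a a'} → F a a' ≡ true → restore W a a' ≡ (deg W a ≡ᵇ 1)
  restore-on-F W⊆Y aa' rewrite off-F W⊆Y aa' | aa' = refl

  -- restoring an admissible W gives a 2-factor: each vertex gets its W-degree
  -- topped up to 2 by the F-edge exactly when that degree is 1
  restore-twoFactor : ∀ {W} → AdmissibleW G F W → TwoFactor G (restore W)
  restore-twoFactor {W} adm@(W-sym , W⊆Y , _) = sym-restore , restore⊆G , deg-restore
    where
    sym-restore : Symmetric (restore W)
    sym-restore i j = cong₂ _∨_ (W-sym i j)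
      (∧-cong-guarded (F-sym i j) (λ ij → cong (_≡ᵇ 1) (proj₁ (admissible⇒balanced adm ij))))
    restore⊆G : restore W ⊆ₘ G
    restore⊆G i j ij with ∨-true ij
    ... | inj₁ w = ∧-conicalˡ _ _ (W⊆Y i j w)
    ... | inj₂ f = F⊆G i j (∧-conicalˡ _ _ f)
    fill : ∀ {d} → d ≡ 1 ⊎ d ≡ 2 → d + ind (d ≡ᵇ 1) ≡ 2
    fill (inj₁ refl) = refl
    fill (inj₂ refl) = refl
    deg-restore : ∀ i → deg (restore W) i ≡ 2
    deg-restore i = begin
      deg (restore W) i                                  ≡⟨ deg-split (restore W) (partner-F i) ⟩
      deg (Y (restore W) F) i + ind (restore W i (partner i))
                                                         ≡⟨ cong₂ _+_ (deg-cong (Y (restore W) F) W i (φ-restore W⊆Y i))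
                                                                      (cong ind (restore-on-F W⊆Y (partner-F i))) ⟩
      deg W i + ind (deg W i ≡ᵇ 1)                       ≡⟨ fill (proj₂ (admissible⇒balanced adm (partner-F i))) ⟩
      2                                                  ∎
      where open ≡-Reasoning

  φ-injective : ∀ {T₁ T₂} → TwoFactor G T₁ → TwoFactor G T₂ → Y T₁ F ≐ Y T₂ F → T₁ ≐ T₂
  φ-injective tf₁ tf₂ eq i j =
    trans (sym (restore-φ tf₁ i j)) (trans (restore-cong eq i j) (restore-φ tf₂ i j))

  module Trails {T : Mat n} (tf : TwoFactor G T) where

    W : Mat n
    W = Y T F

    used⇔degree-two : ∀ {a a'} → F a a' ≡ true → (T a a' ≡ true) ⇔ (deg W a + deg W a' ≡ 2)
    used⇔degree-two aa' rewrite uses-F-edge tf aa' with twoFactor-balanced tf aa'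
    ... | same , inj₁ one rewrite sym same | one = mk⇔ (λ _ → refl) (λ _ → refl)
    ... | same , inj₂ two rewrite sym same | two = mk⇔ (λ ()) (λ ())

    -- every vertex meets an edge of W, since its W-degree is 1 or 2
    dart-at : Fin n → Dart W
    dart-at a = a , proj₁ incident , proj₂ incident
      where
      positive : ∀ {d} → d ≡ 1 ⊎ d ≡ 2 → d ≢ 0
      positive (inj₁ refl) ()
      positive (inj₂ refl) ()
      incident : ∃ λ b → W a b ≡ true
      incident = count-witness (W a) (λ count≡0 →
        positive (proj₂ (twoFactor-balanced tf (partner-F a))) (trans (deg≡count W a) count≡0))

    vertex : Dart W → Fin n
    vertex = proj₁

    same-vertex-linked : ∀ {a b d} (p : W a b ≡ true) (q : W a d ≡ true) →
      EqClosure (Link F W) (a , b , p) (a , d , q)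
    same-vertex-linked {a} {b} {d} p q with b ≟ᶠ d
    ... | yes refl = subst (λ r → EqClosure (Link F W) (a , b , p) (a , b , r))
                           (Decidable⇒UIP.≡-irrelevant _≟ᵇ_ p q) ε
    ... | no b≢d with proj₁ (proj₂ (proj₂ (φ-admissible tf)) a (partner a) (partner-F a))
    ...   | inj₁ two = fwd (inj₂ (deg2-same p q (partner-F a) two b≢d)) ◅ ε
    ...   | inj₂ four = fwd (inj₂ (deg4 p q (partner-F a) four b≢d)) ◅ ε

    -- a T-edge off F is a W-edge; a T-edge on F is a traversing transition
    edge-linked : ∀ {x y} → Edge T x y → EqClosure (Link F W) (dart-at x) (dart-at y)
    edge-linked {x} {y} xy with F x y in eF
    ... | false = same-vertex-linked (proj₂ (proj₂ (dart-at x))) p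
                    ◅◅ fwd (inj₁ (rev p q)) ◅ same-vertex-linked q (proj₂ (proj₂ (dart-at y)))
      where
      p : W x y ≡ true
      p = cong₂ _∧_ xy (cong not eF)
      q : W y x ≡ true
      q = trans (Y-sym (proj₁ tf) y x) p
    ... | true = fwd (inj₂ (deg2-other (proj₂ (proj₂ (dart-at x))) (proj₂ (proj₂ (dart-at y))) eF
                                       (Equivalence.to (used⇔degree-two eF) xy))) ◅ ε

    link-connected : ∀ {u v} → Link F W u v → EqClosure (Edge T) (vertex u) (vertex v)
    link-connected (inj₁ (rev p _)) = fwd (∧-conicalˡ _ _ p) ◅ ε
    link-connected (inj₂ (deg4 _ _ _ _ _)) = ε
    link-connected (inj₂ (deg2-same _ _ _ _ _)) = ε
    link-connected (inj₂ (deg2-other _ _ aa' two)) = fwd (Equivalence.from (used⇔degree-two aa') two) ◅ ε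

    dart-at-vertex : ∀ u → EqClosure (Link F W) (dart-at (vertex u)) u
    dart-at-vertex (a , b , p) = same-vertex-linked (proj₂ (proj₂ (dart-at a))) p

    vertex-dart-at : ∀ x → EqClosure (Edge T) (vertex (dart-at x)) x
    vertex-dart-at x = ε

    cycles⇔trails : ∀ k → NumCycles T k ⇔ NumTrails F W k
    cycles⇔trails k = mk⇔
      (components-transfer dart-at vertex edge-linked link-connected dart-at-vertex vertex-dart-at k)
      (components-transfer vertex dart-at link-connected edge-linked vertex-dart-at dart-at-vertex k)

lemma3 : (n : ℕ) (G F : Mat n) → IsGraph G → Connected G → Cubic G → OneFactor G F →
    Σ (Mat n → Mat n) λ φ →
      (∀ T → TwoFactor G T → AdmissibleW G F (φ T)) ×
      (∀ T₁ T₂ → TwoFactor G T₁ → TwoFactor G T₂ → φ T₁ ≐ φ T₂ → T₁ ≐ T₂) ×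
      (∀ W → AdmissibleW G F W → ∃ λ T → TwoFactor G T × φ T ≐ W) ×
      (∀ T → TwoFactor G T → ∀ k → NumCycles T k ⇔ NumTrails F (φ T) k)
lemma3 n G F _ _ cubic matching =
  (λ T → Y T F) ,
  (λ _ → φ-admissible) ,
  (λ _ _ → φ-injective) ,
  (λ W adm → restore W , restore-twoFactor adm , φ-restore (proj₁ (proj₂ adm))) ,
  (λ _ tf → Trails.cycles⇔trails tf)
  where open CubicWithMatching G F cubic matching
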